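{- Let $n\ge 2$ be an integer. Let $P(n)$ be the set of palindromes of $n$, and let $\mathcal{G}_P(n)=\{\Omega\subseteq\mathbb{Z}_n \mid 0\in\Omega,\ \Omega=-\Omega\}$ (the connection sets of circulant graphs of order $n$). For $\Omega=\{a_1,\ldots,a_t\}$ with $0=a_1<a_2<\cdots<a_t\le n-1$ define $\sigma_\Omega=\omega_1\cdots\omega_t$ with $\omega_i=a_{i+1}-a_i$ for $1\le i\le t-1$ and $\omega_t=n-a_t$. Then $\Omega\mapsto\sigma_\Omega$ is a bijection from $\mathcal{G}_P(n)$ onto $P(n)$; in particular there is a one-to-one correspondence between the set of palindromes of $n$ and the set of circulant graphs of order $n$.
   Context: A composition of $n$ is a finite ordered word $\sigma_1\cdots\sigma_m$ of positive integers summing to $n$; it is a palindrome if $\sigma_1\cdots\sigma_m=\sigma_m\cdots\sigma_1$. For $S\subseteq\mathbb{Z}_n$ with $S=-S$, the circulant graph $G(n,S)$ has vertex set $\{0,\ldots,n-1\}$ and edges $\{i,j\}$ with $i\ne j$, $j-i\in S\pmod n$; circulant graphs of order $n$ are identified with their connection sets in $\mathcal{G}_P(n)$. -}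

module Defs where

open import Data.Nat using (ℕ; zero; suc; _+_; _∸_; _<_; _≤_)
open import Data.Nat.DivMod using (_mod_)
open import Data.Fin using (Fin; toℕ)
open import Data.Fin.Subset using (Subset; _∈_; inside; outside)
open import Data.List using (List; []; _∷_; map; reverse; filterᵇ; allFin)
open import Data.Nat.ListAction using (sum)
open import Data.Empty using (⊥)
open import Data.List.Relation.Unary.All using (All)
open import Data.Vec using (lookup)
open import Data.Bool using (Bool; true; false)
open import Data.Product using (_×_)
open import Relation.Binary.PropositionalEquality using (_≡_)

-- We work with ℤ_n for n = suc m (n ≥ 1), elements are Fin (suc m).

neg : ∀ {m} → Fin (suc m) → Fin (suc m)
neg {m} i = (suc m ∸ toℕ i) mod (suc m)

GP : (n : ℕ) → Subset n → Set
GP zero Ω = ⊥  -- ℤ_0 is not considered (n ≥ 2 in the theorem)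
GP (suc m) Ω = (Fin.zero ∈ Ω) × (∀ (i : Fin (suc m)) → i ∈ Ω → neg i ∈ Ω)

IsComposition : ℕ → List ℕ → Set
IsComposition n σ = All (λ k → 0 < k) σ × sum σ ≡ n

IsPalindrome : ℕ → List ℕ → Set
IsPalindrome n σ = IsComposition n σ × reverse σ ≡ σ

isIn : ∀ {n} → Subset n → Fin n → Bool
isIn Ω i with lookup Ω i
... | inside = true
... | outside = false

elems : (n : ℕ) → Subset n → List ℕ
elems n Ω = map toℕ (filterᵇ (isIn Ω) (allFin n))

gaps : ℕ → List ℕ → List ℕ
gaps n [] = []
gaps n (a ∷ []) = n ∸ a ∷ []
gaps n (a ∷ b ∷ as) = (b ∸ a) ∷ gaps n (b ∷ as)

sigma : (n : ℕ) → Subset n → List ℕ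
sigma n Ω = gaps n (elems n Ω)

-- Listing Ω ⊆ ℤ_n in increasing order identifies subsets with increasing lists below n, and
-- σ_Ω is the list of gaps of 0 = a₁ < ⋯ < a_t < n.  The reflection x ↦ n − x reverses the
-- nonzero elements, so it turns the gaps of Ω into the gaps of −Ω read backwards.  As an
-- increasing list starting at 0 is recovered from its gaps by partial sums, Ω = −Ω holds
-- exactly when σ_Ω is a palindrome, and the partial sums of a palindrome give its preimage.
module Submission where

open import Defs
open import Data.Bool using (true; false; T)
open import Data.Bool.Properties using (T-≡)
open import Data.Empty using (⊥-elim)
open import Data.Fin as Fin using (Fin; toℕ)
open import Data.Fin.Properties using (toℕ-fromℕ<; toℕ-injective; toℕ<n)
open import Data.Fin.Subset using (Subset; _∈_)
open import Data.Fin.Subset.Properties using (⊆-antisym)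
open import Data.List using (List; []; _∷_; _∷ʳ_; [_]; map; reverse; filterᵇ; allFin)
open import Data.List.Properties using (unfold-reverse; map-++; reverse-++; ∷-injectiveʳ)
open import Data.List.Membership.Propositional using () renaming (_∈_ to _∈ₗ_)
open import Data.List.Membership.Propositional.Properties
  using (∈-map⁺; ∈-map⁻; ∈-filter⁺; ∈-filter⁻; ∈-allFin)
open import Data.List.Relation.Binary.Subset.Propositional using () renaming (_⊆_ to _⊆ₗ_)
open import Data.List.Relation.Unary.All as All using (All; []; _∷_)
import Data.List.Relation.Unary.All.Properties as AllP
open import Data.List.Relation.Unary.AllPairs using (AllPairs; []; _∷_)
import Data.List.Relation.Unary.AllPairs.Properties as AllPairsP
open import Data.List.Relation.Unary.Any using (here; there)
import Data.List.Relation.Unary.Any.Properties as AnyP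
open import Data.Nat using (ℕ; suc; _+_; _∸_; _<_; _≤_; _>_; _≟_; z≤n; s≤s)
open import Data.Nat.Properties
open import Data.Nat.DivMod using (_%_; m<n⇒m%n≡m; n%n≡0)
open import Data.Nat.ListAction using (sum)
open import Data.List.Membership.DecPropositional _≟_ using (_∈?_)
open import Data.Product using (_×_; Σ; ∃-syntax; _,_; proj₁; proj₂)
open import Data.Unit using (tt)
open import Data.Vec using (lookup) renaming (tabulate to tabulateᵥ)
open import Data.Vec.Properties using ([]=⇒lookup; lookup⇒[]=; lookup∘tabulate)
open import Function using (_∘_; flip; _⇔_; mk⇔; Equivalence)
import Function.Properties.Equivalence as ⇔
open import Relation.Nullary.Decidable using (does; yes; no; dec-true; T?)
open import Relation.Binary.PropositionalEquality
  using (_≡_; refl; sym; trans; cong; cong₂; subst; module ≡-Reasoning)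

Increasing : List ℕ → Set
Increasing = AllPairs _<_

IncreasingBelow : ℕ → List ℕ → Set
IncreasingBelow n xs = Increasing xs × All (_< n) xs

∈-tail : ∀ {x y xs} → x < y → y ∈ₗ x ∷ xs → y ∈ₗ xs
∈-tail x<x (here refl)  = ⊥-elim (<-irrefl refl x<x)
∈-tail _   (there y∈xs) = y∈xs

⊆-∷-tail : ∀ {x xs ys} → All (x <_) xs → x ∷ xs ⊆ₗ x ∷ ys → xs ⊆ₗ ys
⊆-∷-tail x<xs ⊆ z∈xs = ∈-tail (All.lookup x<xs z∈xs) (⊆ (there z∈xs))

increasing-⊆-antisym : ∀ {xs ys} → Increasing xs → Increasing ys →
  xs ⊆ₗ ys → ys ⊆ₗ xs → xs ≡ ys
increasing-⊆-antisym [] [] _ _ = refl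
increasing-⊆-antisym [] (_ ∷ _) _ ys⊆xs with ys⊆xs (here refl)
... | ()
increasing-⊆-antisym (_ ∷ _) [] xs⊆ys _ with xs⊆ys (here refl)
... | ()
increasing-⊆-antisym {x ∷ _} (x<xs ∷ ↗xs) (y<ys ∷ ↗ys) xs⊆ys ys⊆xs
  with xs⊆ys (here refl) | ys⊆xs (here refl)
... | here refl | _ =
  cong (x ∷_) (increasing-⊆-antisym ↗xs ↗ys (⊆-∷-tail x<xs xs⊆ys) (⊆-∷-tail y<ys ys⊆xs))
... | there _ | here refl =
  cong (x ∷_) (increasing-⊆-antisym ↗xs ↗ys (⊆-∷-tail x<xs xs⊆ys) (⊆-∷-tail y<ys ys⊆xs))
... | there x∈ys | there y∈xs =
  ⊥-elim (<-asym (All.lookup x<xs y∈xs) (All.lookup y<ys x∈ys))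

increasing-∋0 : ∀ {xs} → Increasing xs → 0 ∈ₗ xs → ∃[ ys ] xs ≡ 0 ∷ ys
increasing-∋0 (_ ∷ _)    (here refl)  = _ , refl
increasing-∋0 (x<xs ∷ _) (there 0∈xs) = ⊥-elim (n≮0 (All.lookup x<xs 0∈xs))

All-reverse⁺ : ∀ {A : Set} {P : A → Set} {xs} → All P xs → All P (reverse xs)
All-reverse⁺ pxs = All.tabulate (λ x∈ → All.lookup pxs (AnyP.reverse⁻ x∈))

AllPairs-reverse⁺ : ∀ {A : Set} {R : A → A → Set} {xs} →
  AllPairs (flip R) xs → AllPairs R (reverse xs)
AllPairs-reverse⁺ [] = []
AllPairs-reverse⁺ {R = R} {x ∷ xs} (x∼xs ∷ ∼xs) =
  subst (AllPairs R) (sym (unfold-reverse x xs))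
    (AllPairsP.++⁺ (AllPairs-reverse⁺ ∼xs) ([] ∷ []) (All-reverse⁺ (All.map (_∷ []) x∼xs)))

∷ʳ-increasing : ∀ {n xs} → IncreasingBelow n xs → Increasing (xs ∷ʳ n)
∷ʳ-increasing (↗xs , xs<n) = AllPairsP.++⁺ ↗xs ([] ∷ []) (All.map (_∷ []) xs<n)

isIn≡lookup : ∀ {n} (Ω : Subset n) i → isIn Ω i ≡ lookup Ω i
isIn≡lookup Ω i with lookup Ω i
... | true  = refl
... | false = refl

∈⇒isIn : ∀ {n} {Ω : Subset n} {i} → i ∈ Ω → T (isIn Ω i)
∈⇒isIn {Ω = Ω} {i} i∈Ω rewrite isIn≡lookup Ω i | []=⇒lookup i∈Ω = tt

isIn⇒∈ : ∀ {n} {Ω : Subset n} {i} → T (isIn Ω i) → i ∈ Ω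
isIn⇒∈ {Ω = Ω} {i} t = lookup⇒[]= i Ω (Equivalence.to T-≡ (subst T (isIn≡lookup Ω i) t))

elems-increasingBelow : ∀ n (Ω : Subset n) → IncreasingBelow n (elems n Ω)
elems-increasingBelow n Ω =
  AllPairsP.map⁺ (AllPairsP.filter⁺ (T? ∘ isIn Ω) (AllPairsP.tabulate⁺-< (λ i<j → i<j))) ,
  AllP.map⁺ (All.universal toℕ<n _)

∈-elems⁺ : ∀ {n} {Ω : Subset n} {i} → i ∈ Ω → toℕ i ∈ₗ elems n Ω
∈-elems⁺ {Ω = Ω} {i} i∈Ω =
  ∈-map⁺ toℕ (∈-filter⁺ (T? ∘ isIn Ω) (∈-allFin i) (∈⇒isIn i∈Ω))

∈-elems-witness : ∀ {n} {Ω : Subset n} {x} → x ∈ₗ elems n Ω → ∃[ i ] toℕ i ≡ x × i ∈ Ω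
∈-elems-witness {n} {Ω} x∈ with ∈-map⁻ toℕ {xs = filterᵇ (isIn Ω) (allFin n)} x∈
... | i , i∈ , refl = i , refl , isIn⇒∈ (proj₂ (∈-filter⁻ (T? ∘ isIn Ω) {xs = allFin n} i∈))

∈-elems⁻ : ∀ {n} {Ω : Subset n} {i} → toℕ i ∈ₗ elems n Ω → i ∈ Ω
∈-elems⁻ {Ω = Ω} i∈ with ∈-elems-witness i∈
... | j , toℕj≡toℕi , j∈Ω = subst (_∈ Ω) (toℕ-injective toℕj≡toℕi) j∈Ω

elems-injective : ∀ n {Ω Ω′ : Subset n} → elems n Ω ≡ elems n Ω′ → Ω ≡ Ω′
elems-injective n eq = ⊆-antisym
  (λ i∈Ω → ∈-elems⁻ (subst (_ ∈ₗ_) eq (∈-elems⁺ i∈Ω)))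
  (λ i∈Ω′ → ∈-elems⁻ (subst (_ ∈ₗ_) (sym eq) (∈-elems⁺ i∈Ω′)))

fromList : ∀ n → List ℕ → Subset n
fromList n xs = tabulateᵥ (λ i → does (toℕ i ∈? xs))

∈-fromList⁺ : ∀ {n xs} {i : Fin n} → toℕ i ∈ₗ xs → i ∈ fromList n xs
∈-fromList⁺ {xs = xs} {i} i∈xs =
  lookup⇒[]= i _ (trans (lookup∘tabulate _ i) (dec-true (toℕ i ∈? xs) i∈xs))

∈-fromList⁻ : ∀ {n xs} {i : Fin n} → i ∈ fromList n xs → toℕ i ∈ₗ xs
∈-fromList⁻ {xs = xs} {i} i∈
  with toℕ i ∈? xs | trans (sym (lookup∘tabulate _ i)) ([]=⇒lookup i∈)
... | yes i∈xs | _ = i∈xs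
... | no _     | ()

elems-surjective : ∀ n {xs} → IncreasingBelow n xs → ∃[ Ω ] elems n Ω ≡ xs
elems-surjective n {xs} (↗xs , xs<n) =
  fromList n xs ,
  increasing-⊆-antisym (proj₁ (elems-increasingBelow n (fromList n xs))) ↗xs elems⊆xs xs⊆elems
  where
  elems⊆xs : elems n (fromList n xs) ⊆ₗ xs
  elems⊆xs x∈ with ∈-elems-witness x∈
  ... | i , refl , i∈ = ∈-fromList⁻ i∈

  xs⊆elems : xs ⊆ₗ elems n (fromList n xs)
  xs⊆elems x∈xs =
    subst (_∈ₗ _) toℕi≡x (∈-elems⁺ (∈-fromList⁺ (subst (_∈ₗ xs) (sym toℕi≡x) x∈xs)))
    where toℕi≡x = toℕ-fromℕ< (All.lookup xs<n x∈xs)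

diffs : List ℕ → List ℕ
diffs []           = []
diffs (_ ∷ [])     = []
diffs (x ∷ y ∷ xs) = y ∸ x ∷ diffs (y ∷ xs)

gaps≡diffs : ∀ n xs → gaps n xs ≡ diffs (xs ∷ʳ n)
gaps≡diffs n []           = refl
gaps≡diffs n (_ ∷ [])     = refl
gaps≡diffs n (x ∷ y ∷ xs) = cong (y ∸ x ∷_) (gaps≡diffs n (y ∷ xs))

diffs-∷ʳ : ∀ xs y z → diffs (xs ∷ʳ y ∷ʳ z) ≡ diffs (xs ∷ʳ y) ∷ʳ (z ∸ y)
diffs-∷ʳ []            y z = refl
diffs-∷ʳ (_ ∷ [])      y z = refl
diffs-∷ʳ (x ∷ x′ ∷ xs) y z = cong (x′ ∸ x ∷_) (diffs-∷ʳ (x′ ∷ xs) y z)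

[n∸m]∸[n∸o]≡o∸m : ∀ n {m o} → m ≤ o → o ≤ n → (n ∸ m) ∸ (n ∸ o) ≡ o ∸ m
[n∸m]∸[n∸o]≡o∸m n       z≤n       o≤n       = m∸[m∸n]≡n o≤n
[n∸m]∸[n∸o]≡o∸m (suc n) (s≤s m≤o) (s≤s o≤n) = [n∸m]∸[n∸o]≡o∸m n m≤o o≤n

reflect : ℕ → List ℕ → List ℕ
reflect n xs = reverse (map (n ∸_) xs)

∈-reflect⁺ : ∀ n {x xs} → x ∈ₗ xs → n ∸ x ∈ₗ reflect n xs
∈-reflect⁺ n x∈xs = AnyP.reverse⁺ (∈-map⁺ (n ∸_) x∈xs)

∈-reflect⁻ : ∀ n {y xs} → y ∈ₗ reflect n xs → ∃[ x ] x ∈ₗ xs × y ≡ n ∸ x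
∈-reflect⁻ n y∈ = ∈-map⁻ (n ∸_) (AnyP.reverse⁻ y∈)

reflect-0∷∷ʳ : ∀ n xs → reflect n (0 ∷ xs ∷ʳ n) ≡ 0 ∷ reflect n xs ∷ʳ n
reflect-0∷∷ʳ n xs = begin
  reverse (n ∷ map (n ∸_) (xs ∷ʳ n))
    ≡⟨ unfold-reverse n (map (n ∸_) (xs ∷ʳ n)) ⟩
  reverse (map (n ∸_) (xs ∷ʳ n)) ∷ʳ n
    ≡⟨ cong (λ ys → reverse ys ∷ʳ n) (map-++ (n ∸_) xs [ n ]) ⟩
  reverse (map (n ∸_) xs ∷ʳ (n ∸ n)) ∷ʳ n
    ≡⟨ cong (_∷ʳ n) (reverse-++ (map (n ∸_) xs) [ n ∸ n ]) ⟩
  n ∸ n ∷ reflect n xs ∷ʳ n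
    ≡⟨ cong (λ z → z ∷ reflect n xs ∷ʳ n) (n∸n≡0 n) ⟩
  0 ∷ reflect n xs ∷ʳ n ∎
  where open ≡-Reasoning

diffs-reflect : ∀ n {xs} → Increasing xs → All (_≤ n) xs →
  diffs (reflect n xs) ≡ reverse (diffs xs)
diffs-reflect n []       _ = refl
diffs-reflect n (_ ∷ []) _ = refl
diffs-reflect n {x ∷ y ∷ xs} ((x<y ∷ _) ∷ ↗yxs) (_ ∷ yxs≤n@(y≤n ∷ _)) = begin
  diffs (reflect n (x ∷ y ∷ xs))
    ≡⟨ cong diffs (trans (unfold-reverse (f x) (f y ∷ map f xs))
                         (cong (_∷ʳ f x) (unfold-reverse (f y) (map f xs)))) ⟩
  diffs (reflect n xs ∷ʳ f y ∷ʳ f x)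
    ≡⟨ diffs-∷ʳ (reflect n xs) (f y) (f x) ⟩
  diffs (reflect n xs ∷ʳ f y) ∷ʳ (f x ∸ f y)
    ≡⟨ cong₂ _∷ʳ_ (trans (cong diffs (sym (unfold-reverse (f y) (map f xs))))
                         (diffs-reflect n ↗yxs yxs≤n))
                  ([n∸m]∸[n∸o]≡o∸m n (<⇒≤ x<y) y≤n) ⟩
  reverse (diffs (y ∷ xs)) ∷ʳ (y ∸ x)
    ≡⟨ sym (unfold-reverse (y ∸ x) (diffs (y ∷ xs))) ⟩
  reverse (diffs (x ∷ y ∷ xs)) ∎
  where
  open ≡-Reasoning
  f : ℕ → ℕ
  f = n ∸_

gaps-reflect : ∀ n {xs} → IncreasingBelow n (0 ∷ xs) →
  gaps n (0 ∷ reflect n xs) ≡ reverse (gaps n (0 ∷ xs))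
gaps-reflect n {xs} below@(_ , 0xs<n) = begin
  gaps n (0 ∷ reflect n xs)        ≡⟨ gaps≡diffs n (0 ∷ reflect n xs) ⟩
  diffs (0 ∷ reflect n xs ∷ʳ n)    ≡⟨ cong diffs (sym (reflect-0∷∷ʳ n xs)) ⟩
  diffs (reflect n (0 ∷ xs ∷ʳ n))  ≡⟨ diffs-reflect n (∷ʳ-increasing below) 0xsn≤n ⟩
  reverse (diffs (0 ∷ xs ∷ʳ n))    ≡⟨ cong reverse (sym (gaps≡diffs n (0 ∷ xs))) ⟩
  reverse (gaps n (0 ∷ xs))        ∎
  where
  open ≡-Reasoning
  0xsn≤n : All (_≤ n) (0 ∷ xs ∷ʳ n)
  0xsn≤n = AllP.∷ʳ⁺ (All.map <⇒≤ 0xs<n) ≤-refl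

∸-decreasing : ∀ n {xs} → Increasing xs → All (_≤ n) xs →
  AllPairs (λ x y → n ∸ x > n ∸ y) xs
∸-decreasing n []           []         = []
∸-decreasing n (x<xs ∷ ↗xs) (_ ∷ xs≤n) =
  All.zipWith (λ (x<y , y≤n) → ∸-monoʳ-< x<y y≤n) (x<xs , xs≤n) ∷ ∸-decreasing n ↗xs xs≤n

reflect-increasingBelow : ∀ n {xs} → IncreasingBelow n (0 ∷ xs) →
  IncreasingBelow n (0 ∷ reflect n xs)
reflect-increasingBelow n ((0<xs ∷ ↗xs) , 0<n ∷ xs<n) =
  (All-reverse⁺ (AllP.map⁺ (All.map m<n⇒0<n∸m xs<n))
    ∷ AllPairs-reverse⁺ (AllPairsP.map⁺ (∸-decreasing n ↗xs (All.map <⇒≤ xs<n)))) ,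
  0<n ∷ All-reverse⁺ (AllP.map⁺
    (All.zipWith (λ (0<x , x<n) → ∸-monoʳ-< 0<x (<⇒≤ x<n)) (0<xs , xs<n)))

partialSums : ℕ → List ℕ → List ℕ
partialSums a []       = []
partialSums a (k ∷ ks) = a ∷ partialSums (a + k) ks

gaps-partialSums : ∀ n a ks → a + sum ks ≡ n → gaps n (partialSums a ks) ≡ ks
gaps-partialSums n a []            _  = refl
gaps-partialSums n a (k ∷ [])      eq =
  cong [_] (trans (cong (_∸ a) (sym eq)) (trans (m+n∸m≡n a (k + 0)) (+-identityʳ k)))
gaps-partialSums n a (k ∷ k′ ∷ ks) eq =
  cong₂ _∷_ (m+n∸m≡n a k) (gaps-partialSums n (a + k) (k′ ∷ ks) (trans (+-assoc a k _) eq))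

partialSums-gaps : ∀ n {a xs} → Increasing (a ∷ xs) → partialSums a (gaps n (a ∷ xs)) ≡ a ∷ xs
partialSums-gaps n {a} {[]}     _ = refl
partialSums-gaps n {a} {b ∷ xs} ((a<b ∷ _) ∷ ↗bxs) = cong (a ∷_) (begin
  partialSums (a + (b ∸ a)) (gaps n (b ∷ xs))
    ≡⟨ cong (λ c → partialSums c (gaps n (b ∷ xs))) (m+[n∸m]≡n (<⇒≤ a<b)) ⟩
  partialSums b (gaps n (b ∷ xs))
    ≡⟨ partialSums-gaps n ↗bxs ⟩
  b ∷ xs ∎)
  where open ≡-Reasoning

gaps-injective : ∀ n {a xs ys} → Increasing (a ∷ xs) → Increasing (a ∷ ys) →
  gaps n (a ∷ xs) ≡ gaps n (a ∷ ys) → a ∷ xs ≡ a ∷ ys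
gaps-injective n {a} ↗xs ↗ys eq =
  trans (sym (partialSums-gaps n ↗xs)) (trans (cong (partialSums a) eq) (partialSums-gaps n ↗ys))

gaps-positive : ∀ n {a xs} → IncreasingBelow n (a ∷ xs) → All (0 <_) (gaps n (a ∷ xs))
gaps-positive n {xs = []}    (_ , a<n ∷ []) = m<n⇒0<n∸m a<n ∷ []
gaps-positive n {xs = _ ∷ _} ((a<b ∷ _) ∷ ↗bxs , _ ∷ bxs<n) =
  m<n⇒0<n∸m a<b ∷ gaps-positive n (↗bxs , bxs<n)

+-sum-gaps : ∀ n {a xs} → IncreasingBelow n (a ∷ xs) → a + sum (gaps n (a ∷ xs)) ≡ n
+-sum-gaps n {a} {[]}     (_ , a<n ∷ []) =
  trans (cong (a +_) (+-identityʳ (n ∸ a))) (m+[n∸m]≡n (<⇒≤ a<n))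
+-sum-gaps n {a} {b ∷ xs} ((a<b ∷ _) ∷ ↗bxs , _ ∷ bxs<n) = begin
  a + (b ∸ a + sum (gaps n (b ∷ xs))) ≡⟨ sym (+-assoc a (b ∸ a) _) ⟩
  a + (b ∸ a) + sum (gaps n (b ∷ xs)) ≡⟨ cong (_+ sum (gaps n (b ∷ xs))) (m+[n∸m]≡n (<⇒≤ a<b)) ⟩
  b + sum (gaps n (b ∷ xs))           ≡⟨ +-sum-gaps n (↗bxs , bxs<n) ⟩
  n                                   ∎
  where open ≡-Reasoning

partialSums-≥ : ∀ a ks → All (a ≤_) (partialSums a ks)
partialSums-≥ a []       = []
partialSums-≥ a (k ∷ ks) = ≤-refl ∷ All.map (≤-trans (m≤m+n a k)) (partialSums-≥ (a + k) ks)

partialSums-increasingBelow : ∀ n a ks → All (0 <_) ks → a + sum ks ≡ n →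
  IncreasingBelow n (partialSums a ks)
partialSums-increasingBelow n a []       []           _  = [] , []
partialSums-increasingBelow n a (k ∷ ks) (0<k ∷ 0<ks) eq =
  let ↗ks , ks<n = partialSums-increasingBelow n (a + k) ks 0<ks (trans (+-assoc a k (sum ks)) eq)
  in All.map (<-≤-trans (m<m+n a 0<k)) (partialSums-≥ (a + k) ks) ∷ ↗ks ,
     <-≤-trans (m<m+n a (<-≤-trans 0<k (m≤m+n k (sum ks)))) (≤-reflexive eq) ∷ ks<n

ReflectionClosed : ℕ → List ℕ → Set
ReflectionClosed n xs = ∀ {x} → x ∈ₗ xs → n ∸ x ∈ₗ xs

reflectionClosed⇔reflect≡ : ∀ n {xs} → IncreasingBelow n (0 ∷ xs) →
  ReflectionClosed n xs ⇔ (reflect n xs ≡ xs)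
reflectionClosed⇔reflect≡ n {xs} below@((_ ∷ ↗xs) , _ ∷ xs<n) = mk⇔ to from
  where
  to : ReflectionClosed n xs → reflect n xs ≡ xs
  to closed = increasing-⊆-antisym ↗reflect ↗xs reflect⊆xs xs⊆reflect
    where
    ↗reflect : Increasing (reflect n xs)
    ↗reflect with reflect-increasingBelow n below
    ... | (_ ∷ ↗) , _ = ↗

    reflect⊆xs : reflect n xs ⊆ₗ xs
    reflect⊆xs y∈ with ∈-reflect⁻ n {xs = xs} y∈
    ... | x , x∈xs , refl = closed x∈xs

    xs⊆reflect : xs ⊆ₗ reflect n xs
    xs⊆reflect x∈xs = subst (_∈ₗ reflect n xs) (m∸[m∸n]≡n (<⇒≤ (All.lookup xs<n x∈xs)))
                            (∈-reflect⁺ n (closed x∈xs))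

  from : reflect n xs ≡ xs → ReflectionClosed n xs
  from eq x∈xs = subst (_ ∈ₗ_) eq (∈-reflect⁺ n x∈xs)

reflect≡⇔gaps-palindromic : ∀ n {xs} → IncreasingBelow n (0 ∷ xs) →
  (reflect n xs ≡ xs) ⇔ (reverse (gaps n (0 ∷ xs)) ≡ gaps n (0 ∷ xs))
reflect≡⇔gaps-palindromic n {xs} below = mk⇔
  (λ eq → trans (sym (gaps-reflect n below)) (cong (λ ys → gaps n (0 ∷ ys)) eq))
  (λ pal → ∷-injectiveʳ (gaps-injective n (proj₁ (reflect-increasingBelow n below)) (proj₁ below)
                                          (trans (gaps-reflect n below) pal)))

module _ {m : ℕ} where

  private
    N : ℕ
    N = suc m

  toℕ-neg-zero : ∀ {i : Fin N} → toℕ i ≡ 0 → toℕ (neg i) ≡ 0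
  toℕ-neg-zero {i} i≡0 =
    trans (toℕ-fromℕ< _) (trans (cong (λ x → (N ∸ x) % N) i≡0) (n%n≡0 N))

  toℕ-neg-nonzero : ∀ {i : Fin N} → 0 < toℕ i → toℕ (neg i) ≡ N ∸ toℕ i
  toℕ-neg-nonzero {i} 0<i =
    trans (toℕ-fromℕ< _) (m<n⇒m%n≡m (∸-monoʳ-< 0<i (<⇒≤ (toℕ<n i))))

  elems-0∷ : ∀ {Ω : Subset N} → Fin.zero ∈ Ω → ∃[ xs ] elems N Ω ≡ 0 ∷ xs
  elems-0∷ {Ω} 0∈Ω = increasing-∋0 (proj₁ (elems-increasingBelow N Ω)) (∈-elems⁺ 0∈Ω)

  0∷-increasingBelow : ∀ (Ω : Subset N) {xs} → elems N Ω ≡ 0 ∷ xs →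
    IncreasingBelow N (0 ∷ xs)
  0∷-increasingBelow Ω elems≡ = subst (IncreasingBelow N) elems≡ (elems-increasingBelow N Ω)

  GP⇔reflectionClosed : ∀ {Ω : Subset N} {xs} → elems N Ω ≡ 0 ∷ xs →
    GP N Ω ⇔ ReflectionClosed N xs
  GP⇔reflectionClosed {Ω} {xs} elems≡ = mk⇔ to from
    where
    0<xs : All (0 <_) xs
    0<xs with 0∷-increasingBelow Ω elems≡
    ... | (0<xs ∷ _) , _ = 0<xs

    ∈-0∷ : ∀ {i} → i ∈ Ω → toℕ i ∈ₗ 0 ∷ xs
    ∈-0∷ {i} i∈Ω = subst (toℕ i ∈ₗ_) elems≡ (∈-elems⁺ i∈Ω)

    ∈-Ω : ∀ {i} → toℕ i ∈ₗ 0 ∷ xs → i ∈ Ω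
    ∈-Ω {i} i∈ = ∈-elems⁻ (subst (toℕ i ∈ₗ_) (sym elems≡) i∈)

    to : GP N Ω → ReflectionClosed N xs
    to (_ , symmetric) {x} x∈xs with ∈-elems-witness (subst (x ∈ₗ_) (sym elems≡) (there x∈xs))
    ... | i , refl , i∈Ω = ∈-tail (m<n⇒0<n∸m (toℕ<n i))
      (subst (_∈ₗ 0 ∷ xs) (toℕ-neg-nonzero (All.lookup 0<xs x∈xs)) (∈-0∷ (symmetric i i∈Ω)))

    from : ReflectionClosed N xs → GP N Ω
    from closed = ∈-Ω (here refl) , λ i i∈Ω → ∈-Ω (neg-∈ (∈-0∷ i∈Ω))
      where
      neg-∈ : ∀ {i} → toℕ i ∈ₗ 0 ∷ xs → toℕ (neg i) ∈ₗ 0 ∷ xs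
      neg-∈ (here i≡0)   = here (toℕ-neg-zero i≡0)
      neg-∈ (there i∈xs) =
        there (subst (_∈ₗ xs) (sym (toℕ-neg-nonzero (All.lookup 0<xs i∈xs))) (closed i∈xs))

  GP⇔sigma-palindromic : ∀ {Ω : Subset N} → Fin.zero ∈ Ω →
    GP N Ω ⇔ (reverse (sigma N Ω) ≡ sigma N Ω)
  GP⇔sigma-palindromic {Ω} 0∈Ω with elems-0∷ 0∈Ω
  ... | xs , elems≡ =
    subst (λ ys → GP N Ω ⇔ (reverse (gaps N ys) ≡ gaps N ys)) (sym elems≡)
      (⇔.trans (GP⇔reflectionClosed elems≡)
        (⇔.trans (reflectionClosed⇔reflect≡ N below) (reflect≡⇔gaps-palindromic N below)))
    where
    below : IncreasingBelow N (0 ∷ xs)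
    below = 0∷-increasingBelow Ω elems≡

  sigma-isComposition : ∀ {Ω : Subset N} → Fin.zero ∈ Ω → IsComposition N (sigma N Ω)
  sigma-isComposition {Ω} 0∈Ω with elems-0∷ 0∈Ω
  ... | _ , elems≡ = subst (IsComposition N) (cong (gaps N) (sym elems≡))
    (gaps-positive N (0∷-increasingBelow Ω elems≡) , +-sum-gaps N (0∷-increasingBelow Ω elems≡))

  sigma-injective : ∀ {Ω Ω′ : Subset N} → Fin.zero ∈ Ω → Fin.zero ∈ Ω′ →
    sigma N Ω ≡ sigma N Ω′ → Ω ≡ Ω′
  sigma-injective {Ω} {Ω′} 0∈Ω 0∈Ω′ sigma≡ with elems-0∷ 0∈Ω | elems-0∷ 0∈Ω′
  ... | xs , elems≡ | xs′ , elems≡′ = elems-injective N (begin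
    elems N Ω   ≡⟨ elems≡ ⟩
    0 ∷ xs      ≡⟨ gaps-injective N ↗xs ↗xs′ gaps≡ ⟩
    0 ∷ xs′     ≡⟨ sym elems≡′ ⟩
    elems N Ω′  ∎)
    where
    open ≡-Reasoning
    ↗xs : Increasing (0 ∷ xs)
    ↗xs = proj₁ (0∷-increasingBelow Ω elems≡)
    ↗xs′ : Increasing (0 ∷ xs′)
    ↗xs′ = proj₁ (0∷-increasingBelow Ω′ elems≡′)
    gaps≡ : gaps N (0 ∷ xs) ≡ gaps N (0 ∷ xs′)
    gaps≡ = trans (cong (gaps N) (sym elems≡)) (trans sigma≡ (cong (gaps N) elems≡′))

  sigma-surjective : ∀ {σ} → IsComposition N σ → ∃[ Ω ] Fin.zero ∈ Ω × sigma N Ω ≡ σ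
  sigma-surjective {[]}        (_ , ())
  sigma-surjective {σ@(_ ∷ _)} (0<σ , sum≡N)
    with elems-surjective N (partialSums-increasingBelow N 0 σ 0<σ sum≡N)
  ... | Ω , elems≡ =
    Ω , ∈-elems⁻ (subst (0 ∈ₗ_) (sym elems≡) (here refl)) ,
    trans (cong (gaps N) elems≡) (gaps-partialSums N 0 σ sum≡N)

theorem3p1 : (n : ℕ) → 2 ≤ n →
    ((Ω : Subset n) → GP n Ω → IsPalindrome n (sigma n Ω))
    × ((Ω Ω′ : Subset n) → GP n Ω → GP n Ω′ → sigma n Ω ≡ sigma n Ω′ → Ω ≡ Ω′)
    × ((σ : List ℕ) → IsPalindrome n σ → Σ (Subset n) (λ Ω → GP n Ω × sigma n Ω ≡ σ))
theorem3p1 n@(suc _) _ = palindromic , injective , surjective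
  where
  palindromic : (Ω : Subset n) → GP n Ω → IsPalindrome n (sigma n Ω)
  palindromic Ω gp@(0∈Ω , _) =
    sigma-isComposition 0∈Ω , Equivalence.to (GP⇔sigma-palindromic 0∈Ω) gp

  injective : (Ω Ω′ : Subset n) → GP n Ω → GP n Ω′ → sigma n Ω ≡ sigma n Ω′ → Ω ≡ Ω′
  injective _ _ (0∈Ω , _) (0∈Ω′ , _) = sigma-injective 0∈Ω 0∈Ω′

  surjective : (σ : List ℕ) → IsPalindrome n σ → Σ (Subset n) (λ Ω → GP n Ω × sigma n Ω ≡ σ)
  surjective σ (composition , reverse≡) with sigma-surjective composition
  ... | Ω , 0∈Ω , sigma≡σ =
    Ω , Equivalence.from (GP⇔sigma-palindromic 0∈Ω) palindromic-sigma , sigma≡σ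
    where
    palindromic-sigma : reverse (sigma n Ω) ≡ sigma n Ω
    palindromic-sigma = subst (λ τ → reverse τ ≡ τ) (sym sigma≡σ) reverse≡
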